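{- Let $P$ be an HCP term and $\Gamma_1,\dots,\Gamma_n$ environments, and suppose $\vdash P:\Gamma_1\mid\dots\mid\Gamma_n$ in HCP via some derivation $\rho$. Then there exist CP terms $P_1,\dots,P_n$ with $\vdash P_i:\Gamma_i$ in CP for each $i$, such that $\rho \rightsquigarrow^\star \sigma$, where $\sigma$ is a derivation of $\vdash ([\![P_1]\!]\mid\dots\mid[\![P_n]\!]):\Gamma_1\mid\dots\mid\Gamma_n$ obtained by applying H-Mix repeatedly to HCP derivations of $\vdash[\![P_i]\!]:\Gamma_i$, $i=1,\dots,n$.
   Context: Session types: $A,B ::= A\otimes B \mid \mathbf{1} \mid A ⅋ B \mid \bot \mid A\oplus B \mid \mathbf{0} \mid A \& B \mid \top$, with duality the involution $(A\otimes B)^\bot = A^\bot ⅋ B^\bot$, $(A ⅋ B)^\bot = A^\bot\otimes B^\bot$, $\mathbf{1}^\bot=\bot$, $\bot^\bot=\mathbf{1}$, $(A\oplus B)^\bot = A^\bot \& B^\bot$, $(A\& B)^\bot = A^\bot\oplus B^\bot$, $\mathbf{0}^\bot=\top$, $\top^\bot=\mathbf{0}$. An environment is a finite list $x_1:A_1,\dots,x_n:A_n$ of pairwise distinct names with types; $\Gamma,\Delta$ requires disjoint names. A hyper-environment is a finite multiset $\Gamma_1\mid\dots\mid\Gamma_n$ of environments (empty: $\varnothing$); names may be shared between its environments. CP terms: $P,Q ::= x\leftrightarrow y \mid \nu x(P\parallel Q)$ (cut; $x$ bound in $P$ and $Q$) $\mid x[y](P\parallel Q)$ (output; $y$ bound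 in $P$, $x$ continues in $Q$) $\mid x(y).P$ ($y$ bound in $P$) $\mid x[].0 \mid x().P \mid x\triangleleft\mathrm{inl}.P\mid x\triangleleft\mathrm{inr}.P\mid x\triangleright\{\mathrm{inl}:P;\mathrm{inr}:Q\}\mid x\triangleright\{\}$. CP typing $\vdash P:\Gamma$: (Ax) $\vdash x\leftrightarrow y:x:A,y:A^\bot$; (Cut) from $\vdash P:\Gamma,x:A$ and $\vdash Q:\Delta,x:A^\bot$ infer $\vdash \nu x(P\parallel Q):\Gamma,\Delta$; ($\otimes$) from $\vdash P:\Gamma,y:A$ and $\vdash Q:\Delta,x:B$ infer $\vdash x[y](P\parallel Q):\Gamma,\Delta,x:A\otimes B$; ($⅋$) from $\vdash P:\Gamma,y:A,x:B$ infer $\vdash x(y).P:\Gamma,x:A⅋B$; ($\mathbf{1}$) $\vdash x[].0:x:\mathbf{1}$; ($\bot$) from $\vdash P:\Gamma$ infer $\vdash x().P:\Gamma,x:\bot$; ($\oplus_1$) from $\vdash P:\Gamma,x:A$ infer $\vdash x\triangleleft\mathrm{inl}.P:\Gamma,x:A\oplus B$; ($\oplus_2$) from $\vdash P:\Gamma,x:B$ infer $\vdash x\triangleleft\mathrm{inr}.P:\Gamma,x:A\oplus B$; ($\&$) from $\vdash P:\Gamma,x:A$ and $\vdash Q:\Gamma,x:B$ infer $\vdash x\triangleright\{\mathrm{inl}:P;\mathrm{inr}:Q\}:\Gamma,x:A\&B$; ($\top$) $\vdash x\triangleright\{\}:\Gamma,x:\top$; no rule for $\mathbf{0}$. HCP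 terms: $P,Q,R ::= x\leftrightarrow y \mid 0 \mid (\nu x)P$ (binds $x$) $\mid (P \mid Q) \mid x[y].P$ ($y$ bound in $P$) $\mid x(y).P$ ($y$ bound in $P$) $\mid x[].P \mid x().P \mid x\triangleleft \mathrm{inl}.P \mid x\triangleleft\mathrm{inr}.P \mid x\triangleright\{\mathrm{inl}:P;\mathrm{inr}:Q\} \mid x\triangleright\{\}$. HCP typing $\vdash P:\mathcal{G}$: (Ax) $\vdash x\leftrightarrow y : x:A, y:A^\bot$. (H-Cut) from $\vdash P:\mathcal{G}\mid \Gamma, x:A \mid \Delta, x:A^\bot$ infer $\vdash (\nu x)P : \mathcal{G}\mid \Gamma,\Delta$. (H-Mix) from $\vdash P:\mathcal{G}$, $\vdash Q:\mathcal{H}$ infer $\vdash (P\mid Q): \mathcal{G}\mid\mathcal{H}$. (H-Mix$_0$) $\vdash 0:\varnothing$. ($\otimes$) from $\vdash P : \mathcal{G}\mid \Gamma, y:A \mid \Delta, x:B$ infer $\vdash x[y].P : \mathcal{G}\mid\Gamma,\Delta,x:A\otimes B$. ($⅋$) from $\vdash P : \mathcal{G}\mid\Gamma, y:A, x:B$ infer $\vdash x(y).P : \mathcal{G}\mid\Gamma, x:A⅋B$. ($\mathbf{1}$) from $\vdash P:\mathcal{G}$ infer $\vdash x[].P : \mathcal{G}\mid x:\mathbf{1}$. ($\bot$) from $\vdash P:\mathcal{G}\mid\Gamma$ infer $\vdash x().P : \mathcal{G}\mid\Gamma,x:\bot$. ($\oplus_1$) from $\vdash P:\mathcal{G}\mid\Gamma,x:A$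 infer $\vdash x\triangleleft\mathrm{inl}.P:\mathcal{G}\mid\Gamma,x:A\oplus B$; ($\oplus_2$) analogously with $\mathrm{inr}$ and $x:B$. ($\&$) from $\vdash P:\Gamma,x:A$ and $\vdash Q:\Gamma,x:B$ infer $\vdash x\triangleright\{\mathrm{inl}:P;\mathrm{inr}:Q\}:\Gamma,x:A\&B$. ($\top$) $\vdash x\triangleright\{\}:\Gamma,x:\top$. No rule for $\mathbf{0}$. Each logical rule ($\otimes,⅋,\mathbf{1},\bot,\oplus_1,\oplus_2$) has the side condition that $x$ does not occur in $\mathcal{G}$. HCP structural congruence $\equiv$: smallest congruence containing $x\leftrightarrow y\equiv y\leftrightarrow x$; $(P\mid 0)\equiv P$; $(P\mid Q)\equiv(Q\mid P)$; $(P\mid(Q\mid R))\equiv((P\mid Q)\mid R)$; $(\nu x)(\nu y)P\equiv(\nu y)(\nu x)P$; $(\nu x)(P\mid Q)\equiv (P\mid(\nu x)Q)$ if $x$ not free in $P$. The translation $[\![\cdot]\!]$ from CP to HCP terms: $[\![x\leftrightarrow y]\!]=x\leftrightarrow y$; $[\![\nu x(P\parallel Q)]\!]=(\nu x)([\![P]\!]\mid[\![Q]\!])$; $[\![x[y](P\parallel Q)]\!]=x[y].([\![P]\!]\mid[\![Q]\!])$; $[\![x(y).P]\!]=x(y).[\![P]\!]$; $[\![x[].0]\!]=x[].0$; $[\![x().P]\!]=x().[\![P]\!]$; $[\![x\triangleleft\mathrm{inl}.P]\!]=x\triangleleft\mathrm{inl}.[\![P]\!]$; $[\![x\triangleleft\mathrm{inr}.P]\!]=x\triangleleft\mathrm{inr}.[\![P]\!]$;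 $[\![x\triangleright\{\mathrm{inl}:P;\mathrm{inr}:Q\}]\!]=x\triangleright\{\mathrm{inl}:[\![P]\!];\mathrm{inr}:[\![Q]\!]\}$; $[\![x\triangleright\{\}]\!]=x\triangleright\{\}$. Disentanglement $\rightsquigarrow$ is the smallest relation on HCP typing derivations closed under the following rewrites (plus the HCP structural congruence on the terms), where $D_P$ is a derivation of the indicated judgement for $P$ and $D_Q$ a derivation of $\vdash Q:\mathcal{H}$; $\rightsquigarrow^\star$ is its reflexive transitive closure: (1) H-Cut applied to H-Mix($D_P$, $D_Q$), with $D_P$ deriving $\vdash P:\mathcal{G}\mid\Gamma,x:A\mid\Delta,x:A^\bot$, concluding $\vdash(\nu x)(P\mid Q):\mathcal{G}\mid\mathcal{H}\mid\Gamma,\Delta$, rewrites to H-Mix(H-Cut($D_P$), $D_Q$) concluding $\vdash((\nu x)P\mid Q):\mathcal{G}\mid\mathcal{H}\mid\Gamma,\Delta$. (2) ($\otimes$) applied to H-Mix($D_P$, $D_Q$), with $D_P$ deriving $\vdash P:\mathcal{G}\mid\Gamma,y:A\mid\Delta,x:B$, concluding $\vdash x[y].(P\mid Q):\mathcal{G}\mid\mathcal{H}\mid\Gamma,\Delta,x:A\otimes B$, rewrites to H-Mix(($\otimes$)($D_P$), $D_Q$) concluding $\vdash(x[y].P\mid Q)$ with the same hyper-environment. (3) ($⅋$) applied to H-Mix($D_P$, $D_Q$), with $D_P$ deriving $\vdash P:\mathcal{G}\mid\Gamma,y:A,x:B$, concluding $\vdash x(y).(P\mid Q):\mathcal{G}\mid\mathcal{H}\mid\Gamma,x:A⅋B$,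 rewrites to H-Mix(($⅋$)($D_P$), $D_Q$) concluding $\vdash(x(y).P\mid Q)$ with the same hyper-environment. (4) ($\mathbf{1}$) applied to $D_P$ deriving $\vdash P:\mathcal{G}$, concluding $\vdash x[].P:\mathcal{G}\mid x:\mathbf{1}$, rewrites to H-Mix(($\mathbf{1}$)(H-Mix$_0$), $D_P$) concluding $\vdash(x[].0\mid P):\mathcal{G}\mid x:\mathbf{1}$. (5) ($\bot$) applied to H-Mix($D_P$, $D_Q$), with $D_P$ deriving $\vdash P:\mathcal{G}\mid\Gamma$, concluding $\vdash x().(P\mid Q):\mathcal{G}\mid\mathcal{H}\mid\Gamma,x:\bot$, rewrites to H-Mix(($\bot$)($D_P$), $D_Q$) concluding $\vdash(x().P\mid Q)$ with the same hyper-environment. (6) ($\oplus_1$) applied to H-Mix($D_P$, $D_Q$), with $D_P$ deriving $\vdash P:\mathcal{G}\mid\Gamma,x:A$, concluding $\vdash x\triangleleft\mathrm{inl}.(P\mid Q):\mathcal{G}\mid\mathcal{H}\mid\Gamma,x:A\oplus B$, rewrites to H-Mix(($\oplus_1$)($D_P$), $D_Q$) concluding $\vdash(x\triangleleft\mathrm{inl}.P\mid Q)$ with the same hyper-environment. -}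

module Defs where

open import Data.Nat using (ℕ; _≟_)
open import Data.Product using (Σ; _×_; _,_; proj₁)
open import Data.List using (List; []; _∷_; [_]; _++_; _∷ʳ_; map; concat; filter)
open import Data.List.Membership.Propositional using (_∉_)
open import Data.List.Relation.Unary.Unique.Propositional using (Unique)
open import Data.List.Relation.Binary.Pointwise using (Pointwise; []; _∷_)
import Data.List.Relation.Binary.Permutation.Propositional as PermP
import Data.List.Relation.Binary.Permutation.Setoid as PermS
open import Relation.Binary.Bundles using (Setoid)
open import Level using (0ℓ)
open import Relation.Binary.PropositionalEquality using (_≡_)
open import Relation.Binary.Construct.Closure.ReflexiveTransitive using (Star)
open import Relation.Nullary using (¬?)

Name : Set
Name = ℕ

infixr 6 _⊗_ _⅋_ _⊕_ _&_

data Ty : Set where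
  _⊗_ : Ty → Ty → Ty
  𝟏   : Ty
  _⅋_ : Ty → Ty → Ty
  ⊥ᵗ  : Ty
  _⊕_ : Ty → Ty → Ty
  𝟎   : Ty
  _&_ : Ty → Ty → Ty
  ⊤ᵗ  : Ty

_^⊥ : Ty → Ty
(A ⊗ B) ^⊥ = (A ^⊥) ⅋ (B ^⊥)
(A ⅋ B) ^⊥ = (A ^⊥) ⊗ (B ^⊥)
𝟏 ^⊥ = ⊥ᵗ
⊥ᵗ ^⊥ = 𝟏
(A ⊕ B) ^⊥ = (A ^⊥) & (B ^⊥)
(A & B) ^⊥ = (A ^⊥) ⊕ (B ^⊥)
𝟎 ^⊥ = ⊤ᵗ
⊤ᵗ ^⊥ = 𝟎

-- Environments (lists of name/type pairs, considered up to permutation)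
-- and hyper-environments (multisets of environments, i.e. lists up to
-- permutation, where environments are compared up to permutation).

Env : Set
Env = List (Name × Ty)

HEnv : Set
HEnv = List Env

names : Env → List Name
names Γ = map proj₁ Γ

WF : Env → Set
WF Γ = Unique (names Γ)

namesₕ : HEnv → List Name
namesₕ 𝒢 = concat (map names 𝒢)

_#_ : Name → HEnv → Set
x # 𝒢 = x ∉ namesₕ 𝒢

_≈ₑ_ : Env → Env → Set
Γ ≈ₑ Δ = Γ PermP.↭ Δ

EnvSetoid : Setoid 0ℓ 0ℓ
EnvSetoid = PermP.↭-setoid {A = Name × Ty}

_≈ₕ_ : HEnv → HEnv → Set
𝒢 ≈ₕ ℋ = PermS._↭_ EnvSetoid 𝒢 ℋ

data CP : Set where
  link  : Name → Name → CP
  cut   : Name → CP → CP → CP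
  out   : Name → Name → CP → CP → CP       -- x[y](P ∥ Q)
  inp   : Name → Name → CP → CP            -- x(y).P
  halt  : Name → CP
  wait  : Name → CP → CP
  inl   : Name → CP → CP
  inr   : Name → CP → CP
  case  : Name → CP → CP → CP
  absurd : Name → CP

infix 4 ⊢cp_∶_
data ⊢cp_∶_ : CP → Env → Set where
  ax   : ∀ {x y A Θ} →
         WF ((x , A) ∷ (y , A ^⊥) ∷ []) →
         Θ ≈ₑ ((x , A) ∷ (y , A ^⊥) ∷ []) →
         ⊢cp link x y ∶ Θ
  cutR : ∀ {x P Q Γ Δ A Θ} →
         ⊢cp P ∶ Γ ∷ʳ (x , A) → ⊢cp Q ∶ Δ ∷ʳ (x , A ^⊥) →
         WF (Γ ++ Δ) → Θ ≈ₑ (Γ ++ Δ) →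
         ⊢cp cut x P Q ∶ Θ
  ⊗R   : ∀ {x y P Q Γ Δ A B Θ} →
         ⊢cp P ∶ Γ ∷ʳ (y , A) → ⊢cp Q ∶ Δ ∷ʳ (x , B) →
         WF (Γ ++ Δ ∷ʳ (x , A ⊗ B)) → Θ ≈ₑ (Γ ++ Δ ∷ʳ (x , A ⊗ B)) →
         ⊢cp out x y P Q ∶ Θ
  ⅋R   : ∀ {x y P Γ A B Θ} →
         ⊢cp P ∶ Γ ∷ʳ (y , A) ∷ʳ (x , B) →
         WF (Γ ∷ʳ (x , A ⅋ B)) → Θ ≈ₑ (Γ ∷ʳ (x , A ⅋ B)) →
         ⊢cp inp x y P ∶ Θ
  𝟏R   : ∀ {x Θ} →
         Θ ≈ₑ [ (x , 𝟏) ] →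
         ⊢cp halt x ∶ Θ
  ⊥R   : ∀ {x P Γ Θ} →
         ⊢cp P ∶ Γ →
         WF (Γ ∷ʳ (x , ⊥ᵗ)) → Θ ≈ₑ (Γ ∷ʳ (x , ⊥ᵗ)) →
         ⊢cp wait x P ∶ Θ
  ⊕₁R  : ∀ {x P Γ A B Θ} →
         ⊢cp P ∶ Γ ∷ʳ (x , A) →
         WF (Γ ∷ʳ (x , A ⊕ B)) → Θ ≈ₑ (Γ ∷ʳ (x , A ⊕ B)) →
         ⊢cp inl x P ∶ Θ
  ⊕₂R  : ∀ {x P Γ A B Θ} →
         ⊢cp P ∶ Γ ∷ʳ (x , B) →
         WF (Γ ∷ʳ (x , A ⊕ B)) → Θ ≈ₑ (Γ ∷ʳ (x , A ⊕ B)) →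
         ⊢cp inr x P ∶ Θ
  &R   : ∀ {x P Q Γ A B Θ} →
         ⊢cp P ∶ Γ ∷ʳ (x , A) → ⊢cp Q ∶ Γ ∷ʳ (x , B) →
         WF (Γ ∷ʳ (x , A & B)) → Θ ≈ₑ (Γ ∷ʳ (x , A & B)) →
         ⊢cp case x P Q ∶ Θ
  ⊤R   : ∀ {x Γ Θ} →
         WF (Γ ∷ʳ (x , ⊤ᵗ)) → Θ ≈ₑ (Γ ∷ʳ (x , ⊤ᵗ)) →
         ⊢cp absurd x ∶ Θ

infixr 5 _∣_
data HCP : Set where
  link  : Name → Name → HCP
  𝟘     : HCP
  ν     : Name → HCP → HCP
  _∣_   : HCP → HCP → HCP
  out   : Name → Name → HCP → HCP
  inp   : Name → Name → HCP → HCP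
  halt  : Name → HCP → HCP
  wait  : Name → HCP → HCP
  inl   : Name → HCP → HCP
  inr   : Name → HCP → HCP
  case  : Name → HCP → HCP → HCP
  absurd : Name → HCP

_∖_ : List Name → Name → List Name
xs ∖ x = filter (λ z → ¬? (z ≟ x)) xs

fv : HCP → List Name
fv (link x y) = x ∷ y ∷ []
fv 𝟘 = []
fv (ν x P) = fv P ∖ x
fv (P ∣ Q) = fv P ++ fv Q
fv (out x y P) = x ∷ (fv P ∖ y)
fv (inp x y P) = x ∷ (fv P ∖ y)
fv (halt x P) = x ∷ fv P
fv (wait x P) = x ∷ fv P
fv (inl x P) = x ∷ fv P
fv (inr x P) = x ∷ fv P
fv (case x P Q) = x ∷ (fv P ++ fv Q)
fv (absurd x) = x ∷ []

infix 4 _≡ₛ_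
data _≡ₛ_ : HCP → HCP → Set where
  ≡-refl  : ∀ {P} → P ≡ₛ P
  ≡-sym   : ∀ {P Q} → P ≡ₛ Q → Q ≡ₛ P
  ≡-trans : ∀ {P Q R} → P ≡ₛ Q → Q ≡ₛ R → P ≡ₛ R
  link-sym  : ∀ {x y} → link x y ≡ₛ link y x
  par-unit  : ∀ {P} → (P ∣ 𝟘) ≡ₛ P
  par-comm  : ∀ {P Q} → (P ∣ Q) ≡ₛ (Q ∣ P)
  par-assoc : ∀ {P Q R} → (P ∣ (Q ∣ R)) ≡ₛ ((P ∣ Q) ∣ R)
  ν-comm    : ∀ {x y P} → ν x (ν y P) ≡ₛ ν y (ν x P)
  ν-ext     : ∀ {x P Q} → x ∉ fv P → ν x (P ∣ Q) ≡ₛ (P ∣ ν x Q)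
  c-ν    : ∀ {x P P′} → P ≡ₛ P′ → ν x P ≡ₛ ν x P′
  c-∣    : ∀ {P P′ Q Q′} → P ≡ₛ P′ → Q ≡ₛ Q′ → (P ∣ Q) ≡ₛ (P′ ∣ Q′)
  c-out  : ∀ {x y P P′} → P ≡ₛ P′ → out x y P ≡ₛ out x y P′
  c-inp  : ∀ {x y P P′} → P ≡ₛ P′ → inp x y P ≡ₛ inp x y P′
  c-halt : ∀ {x P P′} → P ≡ₛ P′ → halt x P ≡ₛ halt x P′
  c-wait : ∀ {x P P′} → P ≡ₛ P′ → wait x P ≡ₛ wait x P′
  c-inl  : ∀ {x P P′} → P ≡ₛ P′ → inl x P ≡ₛ inl x P′
  c-inr  : ∀ {x P P′} → P ≡ₛ P′ → inr x P ≡ₛ inr x P′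
  c-case : ∀ {x P P′ Q Q′} → P ≡ₛ P′ → Q ≡ₛ Q′ → case x P Q ≡ₛ case x P′ Q′

-- Newly formed environments must have distinct
-- names; bound names (of ν, and y in x[y] / x(y)) must not occur in the
-- conclusion (Barendregt convention); logical rules require x ∉ 𝒢.

data Der : HCP → HEnv → Set where
  ax   : ∀ {x y A 𝒦} →
         WF ((x , A) ∷ (y , A ^⊥) ∷ []) →
         𝒦 ≈ₕ [ (x , A) ∷ (y , A ^⊥) ∷ [] ] →
         Der (link x y) 𝒦
  hcut : ∀ {x P 𝒢 Γ Δ A 𝒦} →
         Der P (𝒢 ++ (Γ ∷ʳ (x , A)) ∷ (Δ ∷ʳ (x , A ^⊥)) ∷ []) →
         x # (𝒢 ∷ʳ (Γ ++ Δ)) → WF (Γ ++ Δ) →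
         𝒦 ≈ₕ (𝒢 ∷ʳ (Γ ++ Δ)) →
         Der (ν x P) 𝒦
  hmix : ∀ {P Q 𝒢 ℋ 𝒦} →
         Der P 𝒢 → Der Q ℋ →
         𝒦 ≈ₕ (𝒢 ++ ℋ) →
         Der (P ∣ Q) 𝒦
  hmix₀ : Der 𝟘 []
  ⊗R   : ∀ {x y P 𝒢 Γ Δ A B 𝒦} →
         Der P (𝒢 ++ (Γ ∷ʳ (y , A)) ∷ (Δ ∷ʳ (x , B)) ∷ []) →
         x # 𝒢 → y # (𝒢 ∷ʳ (Γ ++ Δ ∷ʳ (x , A ⊗ B))) →
         WF (Γ ++ Δ ∷ʳ (x , A ⊗ B)) →
         𝒦 ≈ₕ (𝒢 ∷ʳ (Γ ++ Δ ∷ʳ (x , A ⊗ B))) →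
         Der (out x y P) 𝒦
  ⅋R   : ∀ {x y P 𝒢 Γ A B 𝒦} →
         Der P (𝒢 ∷ʳ (Γ ∷ʳ (y , A) ∷ʳ (x , B))) →
         x # 𝒢 → y # (𝒢 ∷ʳ (Γ ∷ʳ (x , A ⅋ B))) →
         WF (Γ ∷ʳ (x , A ⅋ B)) →
         𝒦 ≈ₕ (𝒢 ∷ʳ (Γ ∷ʳ (x , A ⅋ B))) →
         Der (inp x y P) 𝒦
  𝟏R   : ∀ {x P 𝒢 𝒦} →
         Der P 𝒢 →
         x # 𝒢 →
         𝒦 ≈ₕ (𝒢 ∷ʳ [ (x , 𝟏) ]) →
         Der (halt x P) 𝒦
  ⊥R   : ∀ {x P 𝒢 Γ 𝒦} →
         Der P (𝒢 ∷ʳ Γ) →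
         x # 𝒢 → WF (Γ ∷ʳ (x , ⊥ᵗ)) →
         𝒦 ≈ₕ (𝒢 ∷ʳ (Γ ∷ʳ (x , ⊥ᵗ))) →
         Der (wait x P) 𝒦
  ⊕₁R  : ∀ {x P 𝒢 Γ A B 𝒦} →
         Der P (𝒢 ∷ʳ (Γ ∷ʳ (x , A))) →
         x # 𝒢 → WF (Γ ∷ʳ (x , A ⊕ B)) →
         𝒦 ≈ₕ (𝒢 ∷ʳ (Γ ∷ʳ (x , A ⊕ B))) →
         Der (inl x P) 𝒦
  ⊕₂R  : ∀ {x P 𝒢 Γ A B 𝒦} →
         Der P (𝒢 ∷ʳ (Γ ∷ʳ (x , B))) →
         x # 𝒢 → WF (Γ ∷ʳ (x , A ⊕ B)) →
         𝒦 ≈ₕ (𝒢 ∷ʳ (Γ ∷ʳ (x , A ⊕ B))) →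
         Der (inr x P) 𝒦
  &R   : ∀ {x P Q Γ A B 𝒦} →
         Der P [ Γ ∷ʳ (x , A) ] → Der Q [ Γ ∷ʳ (x , B) ] →
         WF (Γ ∷ʳ (x , A & B)) →
         𝒦 ≈ₕ [ Γ ∷ʳ (x , A & B) ] →
         Der (case x P Q) 𝒦
  ⊤R   : ∀ {x Γ 𝒦} →
         WF (Γ ∷ʳ (x , ⊤ᵗ)) →
         𝒦 ≈ₕ [ Γ ∷ʳ (x , ⊤ᵗ) ] →
         Der (absurd x) 𝒦

Drv : HEnv → Set
Drv 𝒦 = Σ HCP (λ P → Der P 𝒦)

⟦_⟧ : CP → HCP
⟦ link x y ⟧ = link x y
⟦ cut x P Q ⟧ = ν x (⟦ P ⟧ ∣ ⟦ Q ⟧)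
⟦ out x y P Q ⟧ = out x y (⟦ P ⟧ ∣ ⟦ Q ⟧)
⟦ inp x y P ⟧ = inp x y ⟦ P ⟧
⟦ halt x ⟧ = halt x 𝟘
⟦ wait x P ⟧ = wait x ⟦ P ⟧
⟦ inl x P ⟧ = inl x ⟦ P ⟧
⟦ inr x P ⟧ = inr x ⟦ P ⟧
⟦ case x P Q ⟧ = case x ⟦ P ⟧ ⟦ Q ⟧
⟦ absurd x ⟧ = absurd x

-- Disentanglement: the rewrites (1)-(6) (plus the evident ⊕₂ analogue
-- of (6)), closed under rewriting inside sub-derivations and under
-- structural congruence of the terms.

infix 4 _⇝_
data _⇝_ : {𝒦 : HEnv} → Drv 𝒦 → Drv 𝒦 → Set where
  r-cut : ∀ {x P Q 𝒢 ℋ Γ Δ A 𝒢c 𝒦 𝒦₁}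
          (dP : Der P (𝒢 ++ (Γ ∷ʳ (x , A)) ∷ (Δ ∷ʳ (x , A ^⊥)) ∷ []))
          (dQ : Der Q ℋ)
          (π  : (𝒢c ++ (Γ ∷ʳ (x , A)) ∷ (Δ ∷ʳ (x , A ^⊥)) ∷ [])
                  ≈ₕ ((𝒢 ++ (Γ ∷ʳ (x , A)) ∷ (Δ ∷ʳ (x , A ^⊥)) ∷ []) ++ ℋ))
          (fx : x # (𝒢c ∷ʳ (Γ ++ Δ))) (wf : WF (Γ ++ Δ))
          (π′ : 𝒦 ≈ₕ (𝒢c ∷ʳ (Γ ++ Δ)))
          (fx₁ : x # (𝒢 ∷ʳ (Γ ++ Δ))) (wf₁ : WF (Γ ++ Δ))
          (π₁ : 𝒦₁ ≈ₕ (𝒢 ∷ʳ (Γ ++ Δ))) (π₂ : 𝒦 ≈ₕ (𝒦₁ ++ ℋ)) →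
          (ν x (P ∣ Q) , hcut (hmix dP dQ π) fx wf π′)
            ⇝ ((ν x P ∣ Q) , hmix (hcut dP fx₁ wf₁ π₁) dQ π₂)
  r-⊗   : ∀ {x y P Q 𝒢 ℋ Γ Δ A B 𝒢c 𝒦 𝒦₁}
          (dP : Der P (𝒢 ++ (Γ ∷ʳ (y , A)) ∷ (Δ ∷ʳ (x , B)) ∷ []))
          (dQ : Der Q ℋ)
          (π  : (𝒢c ++ (Γ ∷ʳ (y , A)) ∷ (Δ ∷ʳ (x , B)) ∷ [])
                  ≈ₕ ((𝒢 ++ (Γ ∷ʳ (y , A)) ∷ (Δ ∷ʳ (x , B)) ∷ []) ++ ℋ))
          (fx : x # 𝒢c) (fy : y # (𝒢c ∷ʳ (Γ ++ Δ ∷ʳ (x , A ⊗ B))))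
          (wf : WF (Γ ++ Δ ∷ʳ (x , A ⊗ B)))
          (π′ : 𝒦 ≈ₕ (𝒢c ∷ʳ (Γ ++ Δ ∷ʳ (x , A ⊗ B))))
          (fx₁ : x # 𝒢) (fy₁ : y # (𝒢 ∷ʳ (Γ ++ Δ ∷ʳ (x , A ⊗ B))))
          (wf₁ : WF (Γ ++ Δ ∷ʳ (x , A ⊗ B)))
          (π₁ : 𝒦₁ ≈ₕ (𝒢 ∷ʳ (Γ ++ Δ ∷ʳ (x , A ⊗ B)))) (π₂ : 𝒦 ≈ₕ (𝒦₁ ++ ℋ)) →
          (out x y (P ∣ Q) , ⊗R (hmix dP dQ π) fx fy wf π′)
            ⇝ ((out x y P ∣ Q) , hmix (⊗R dP fx₁ fy₁ wf₁ π₁) dQ π₂)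
  r-⅋   : ∀ {x y P Q 𝒢 ℋ Γ A B 𝒢c 𝒦 𝒦₁}
          (dP : Der P (𝒢 ∷ʳ (Γ ∷ʳ (y , A) ∷ʳ (x , B))))
          (dQ : Der Q ℋ)
          (π  : (𝒢c ∷ʳ (Γ ∷ʳ (y , A) ∷ʳ (x , B)))
                  ≈ₕ ((𝒢 ∷ʳ (Γ ∷ʳ (y , A) ∷ʳ (x , B))) ++ ℋ))
          (fx : x # 𝒢c) (fy : y # (𝒢c ∷ʳ (Γ ∷ʳ (x , A ⅋ B))))
          (wf : WF (Γ ∷ʳ (x , A ⅋ B)))
          (π′ : 𝒦 ≈ₕ (𝒢c ∷ʳ (Γ ∷ʳ (x , A ⅋ B))))
          (fx₁ : x # 𝒢) (fy₁ : y # (𝒢 ∷ʳ (Γ ∷ʳ (x , A ⅋ B))))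
          (wf₁ : WF (Γ ∷ʳ (x , A ⅋ B)))
          (π₁ : 𝒦₁ ≈ₕ (𝒢 ∷ʳ (Γ ∷ʳ (x , A ⅋ B)))) (π₂ : 𝒦 ≈ₕ (𝒦₁ ++ ℋ)) →
          (inp x y (P ∣ Q) , ⅋R (hmix dP dQ π) fx fy wf π′)
            ⇝ ((inp x y P ∣ Q) , hmix (⅋R dP fx₁ fy₁ wf₁ π₁) dQ π₂)
  r-𝟏   : ∀ {x P 𝒢 𝒦 𝒦₁}
          (dP : Der P 𝒢) (fx : x # 𝒢) (π′ : 𝒦 ≈ₕ (𝒢 ∷ʳ [ (x , 𝟏) ]))
          (fx₁ : x # []) (π₁ : 𝒦₁ ≈ₕ ([] ∷ʳ [ (x , 𝟏) ]))
          (π₂ : 𝒦 ≈ₕ (𝒦₁ ++ 𝒢)) →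
          (halt x P , 𝟏R dP fx π′)
            ⇝ ((halt x 𝟘 ∣ P) , hmix (𝟏R hmix₀ fx₁ π₁) dP π₂)
  r-⊥   : ∀ {x P Q 𝒢 ℋ Γ 𝒢c 𝒦 𝒦₁}
          (dP : Der P (𝒢 ∷ʳ Γ)) (dQ : Der Q ℋ)
          (π  : (𝒢c ∷ʳ Γ) ≈ₕ ((𝒢 ∷ʳ Γ) ++ ℋ))
          (fx : x # 𝒢c) (wf : WF (Γ ∷ʳ (x , ⊥ᵗ)))
          (π′ : 𝒦 ≈ₕ (𝒢c ∷ʳ (Γ ∷ʳ (x , ⊥ᵗ))))
          (fx₁ : x # 𝒢) (wf₁ : WF (Γ ∷ʳ (x , ⊥ᵗ)))
          (π₁ : 𝒦₁ ≈ₕ (𝒢 ∷ʳ (Γ ∷ʳ (x , ⊥ᵗ)))) (π₂ : 𝒦 ≈ₕ (𝒦₁ ++ ℋ)) →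
          (wait x (P ∣ Q) , ⊥R (hmix dP dQ π) fx wf π′)
            ⇝ ((wait x P ∣ Q) , hmix (⊥R dP fx₁ wf₁ π₁) dQ π₂)
  r-⊕₁  : ∀ {x P Q 𝒢 ℋ Γ A B 𝒢c 𝒦 𝒦₁}
          (dP : Der P (𝒢 ∷ʳ (Γ ∷ʳ (x , A)))) (dQ : Der Q ℋ)
          (π  : (𝒢c ∷ʳ (Γ ∷ʳ (x , A))) ≈ₕ ((𝒢 ∷ʳ (Γ ∷ʳ (x , A))) ++ ℋ))
          (fx : x # 𝒢c) (wf : WF (Γ ∷ʳ (x , A ⊕ B)))
          (π′ : 𝒦 ≈ₕ (𝒢c ∷ʳ (Γ ∷ʳ (x , A ⊕ B))))
          (fx₁ : x # 𝒢) (wf₁ : WF (Γ ∷ʳ (x , A ⊕ B)))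
          (π₁ : 𝒦₁ ≈ₕ (𝒢 ∷ʳ (Γ ∷ʳ (x , A ⊕ B)))) (π₂ : 𝒦 ≈ₕ (𝒦₁ ++ ℋ)) →
          (inl x (P ∣ Q) , ⊕₁R (hmix dP dQ π) fx wf π′)
            ⇝ ((inl x P ∣ Q) , hmix (⊕₁R dP fx₁ wf₁ π₁) dQ π₂)
  r-⊕₂  : ∀ {x P Q 𝒢 ℋ Γ A B 𝒢c 𝒦 𝒦₁}
          (dP : Der P (𝒢 ∷ʳ (Γ ∷ʳ (x , B)))) (dQ : Der Q ℋ)
          (π  : (𝒢c ∷ʳ (Γ ∷ʳ (x , B))) ≈ₕ ((𝒢 ∷ʳ (Γ ∷ʳ (x , B))) ++ ℋ))
          (fx : x # 𝒢c) (wf : WF (Γ ∷ʳ (x , A ⊕ B)))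
          (π′ : 𝒦 ≈ₕ (𝒢c ∷ʳ (Γ ∷ʳ (x , A ⊕ B))))
          (fx₁ : x # 𝒢) (wf₁ : WF (Γ ∷ʳ (x , A ⊕ B)))
          (π₁ : 𝒦₁ ≈ₕ (𝒢 ∷ʳ (Γ ∷ʳ (x , A ⊕ B)))) (π₂ : 𝒦 ≈ₕ (𝒦₁ ++ ℋ)) →
          (inr x (P ∣ Q) , ⊕₂R (hmix dP dQ π) fx wf π′)
            ⇝ ((inr x P ∣ Q) , hmix (⊕₂R dP fx₁ wf₁ π₁) dQ π₂)
  r-≡   : ∀ {P Q 𝒦} (d : Der P 𝒦) (e : Der Q 𝒦) → P ≡ₛ Q → (P , d) ⇝ (Q , e)
  c-hcut : ∀ {x P P′ 𝒢 Γ Δ A 𝒦}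
           {d : Der P (𝒢 ++ (Γ ∷ʳ (x , A)) ∷ (Δ ∷ʳ (x , A ^⊥)) ∷ [])}
           {d′ : Der P′ (𝒢 ++ (Γ ∷ʳ (x , A)) ∷ (Δ ∷ʳ (x , A ^⊥)) ∷ [])}
           (fx : x # (𝒢 ∷ʳ (Γ ++ Δ))) (wf : WF (Γ ++ Δ))
           (π : 𝒦 ≈ₕ (𝒢 ∷ʳ (Γ ++ Δ))) →
           (P , d) ⇝ (P′ , d′) →
           (ν x P , hcut d fx wf π) ⇝ (ν x P′ , hcut d′ fx wf π)
  c-mixˡ : ∀ {P P′ Q 𝒢 ℋ 𝒦} {d : Der P 𝒢} {d′ : Der P′ 𝒢} (e : Der Q ℋ)
           (π : 𝒦 ≈ₕ (𝒢 ++ ℋ)) →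
           (P , d) ⇝ (P′ , d′) →
           ((P ∣ Q) , hmix d e π) ⇝ ((P′ ∣ Q) , hmix d′ e π)
  c-mixʳ : ∀ {P Q Q′ 𝒢 ℋ 𝒦} (d : Der P 𝒢) {e : Der Q ℋ} {e′ : Der Q′ ℋ}
           (π : 𝒦 ≈ₕ (𝒢 ++ ℋ)) →
           (Q , e) ⇝ (Q′ , e′) →
           ((P ∣ Q) , hmix d e π) ⇝ ((P ∣ Q′) , hmix d e′ π)
  c-⊗   : ∀ {x y P P′ 𝒢 Γ Δ A B 𝒦}
          {d : Der P (𝒢 ++ (Γ ∷ʳ (y , A)) ∷ (Δ ∷ʳ (x , B)) ∷ [])}
          {d′ : Der P′ (𝒢 ++ (Γ ∷ʳ (y , A)) ∷ (Δ ∷ʳ (x , B)) ∷ [])}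
          (fx : x # 𝒢) (fy : y # (𝒢 ∷ʳ (Γ ++ Δ ∷ʳ (x , A ⊗ B))))
          (wf : WF (Γ ++ Δ ∷ʳ (x , A ⊗ B)))
          (π : 𝒦 ≈ₕ (𝒢 ∷ʳ (Γ ++ Δ ∷ʳ (x , A ⊗ B)))) →
          (P , d) ⇝ (P′ , d′) →
          (out x y P , ⊗R d fx fy wf π) ⇝ (out x y P′ , ⊗R d′ fx fy wf π)
  c-⅋   : ∀ {x y P P′ 𝒢 Γ A B 𝒦}
          {d : Der P (𝒢 ∷ʳ (Γ ∷ʳ (y , A) ∷ʳ (x , B)))}
          {d′ : Der P′ (𝒢 ∷ʳ (Γ ∷ʳ (y , A) ∷ʳ (x , B)))}
          (fx : x # 𝒢) (fy : y # (𝒢 ∷ʳ (Γ ∷ʳ (x , A ⅋ B))))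
          (wf : WF (Γ ∷ʳ (x , A ⅋ B)))
          (π : 𝒦 ≈ₕ (𝒢 ∷ʳ (Γ ∷ʳ (x , A ⅋ B)))) →
          (P , d) ⇝ (P′ , d′) →
          (inp x y P , ⅋R d fx fy wf π) ⇝ (inp x y P′ , ⅋R d′ fx fy wf π)
  c-𝟏   : ∀ {x P P′ 𝒢 𝒦} {d : Der P 𝒢} {d′ : Der P′ 𝒢}
          (fx : x # 𝒢) (π : 𝒦 ≈ₕ (𝒢 ∷ʳ [ (x , 𝟏) ])) →
          (P , d) ⇝ (P′ , d′) →
          (halt x P , 𝟏R d fx π) ⇝ (halt x P′ , 𝟏R d′ fx π)
  c-⊥   : ∀ {x P P′ 𝒢 Γ 𝒦} {d : Der P (𝒢 ∷ʳ Γ)} {d′ : Der P′ (𝒢 ∷ʳ Γ)}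
          (fx : x # 𝒢) (wf : WF (Γ ∷ʳ (x , ⊥ᵗ)))
          (π : 𝒦 ≈ₕ (𝒢 ∷ʳ (Γ ∷ʳ (x , ⊥ᵗ)))) →
          (P , d) ⇝ (P′ , d′) →
          (wait x P , ⊥R d fx wf π) ⇝ (wait x P′ , ⊥R d′ fx wf π)
  c-⊕₁  : ∀ {x P P′ 𝒢 Γ A B 𝒦}
          {d : Der P (𝒢 ∷ʳ (Γ ∷ʳ (x , A)))} {d′ : Der P′ (𝒢 ∷ʳ (Γ ∷ʳ (x , A)))}
          (fx : x # 𝒢) (wf : WF (Γ ∷ʳ (x , A ⊕ B)))
          (π : 𝒦 ≈ₕ (𝒢 ∷ʳ (Γ ∷ʳ (x , A ⊕ B)))) →
          (P , d) ⇝ (P′ , d′) →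
          (inl x P , ⊕₁R d fx wf π) ⇝ (inl x P′ , ⊕₁R d′ fx wf π)
  c-⊕₂  : ∀ {x P P′ 𝒢 Γ A B 𝒦}
          {d : Der P (𝒢 ∷ʳ (Γ ∷ʳ (x , B)))} {d′ : Der P′ (𝒢 ∷ʳ (Γ ∷ʳ (x , B)))}
          (fx : x # 𝒢) (wf : WF (Γ ∷ʳ (x , A ⊕ B)))
          (π : 𝒦 ≈ₕ (𝒢 ∷ʳ (Γ ∷ʳ (x , A ⊕ B)))) →
          (P , d) ⇝ (P′ , d′) →
          (inr x P , ⊕₂R d fx wf π) ⇝ (inr x P′ , ⊕₂R d′ fx wf π)
  c-&ˡ  : ∀ {x P P′ Q Γ A B 𝒦}
          {d : Der P [ Γ ∷ʳ (x , A) ]} {d′ : Der P′ [ Γ ∷ʳ (x , A) ]}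
          (e : Der Q [ Γ ∷ʳ (x , B) ])
          (wf : WF (Γ ∷ʳ (x , A & B))) (π : 𝒦 ≈ₕ [ Γ ∷ʳ (x , A & B) ]) →
          (P , d) ⇝ (P′ , d′) →
          (case x P Q , &R d e wf π) ⇝ (case x P′ Q , &R d′ e wf π)
  c-&ʳ  : ∀ {x P Q Q′ Γ A B 𝒦}
          (d : Der P [ Γ ∷ʳ (x , A) ])
          {e : Der Q [ Γ ∷ʳ (x , B) ]} {e′ : Der Q′ [ Γ ∷ʳ (x , B) ]}
          (wf : WF (Γ ∷ʳ (x , A & B))) (π : 𝒦 ≈ₕ [ Γ ∷ʳ (x , A & B) ]) →
          (Q , e) ⇝ (Q′ , e′) →
          (case x P Q , &R d e wf π) ⇝ (case x P Q′ , &R d e′ wf π)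

infix 4 _⇝⋆_
_⇝⋆_ : {𝒦 : HEnv} → Drv 𝒦 → Drv 𝒦 → Set
_⇝⋆_ = Star _⇝_

par : List HCP → HCP
par [] = 𝟘
par (P ∷ []) = P
par (P ∷ Q ∷ Ps) = P ∣ par (Q ∷ Ps)

≈ₕ-refl : ∀ {𝒢} → 𝒢 ≈ₕ 𝒢
≈ₕ-refl = PermS.↭-refl EnvSetoid

mixAll : ∀ {Ps : List CP} {Γs : List Env} →
         Pointwise (λ P Γ → Der ⟦ P ⟧ [ Γ ]) Ps Γs →
         Der (par (map ⟦_⟧ Ps)) Γs
mixAll [] = hmix₀
mixAll (τ ∷ []) = τ
mixAll (τ ∷ (τ′ ∷ τs)) = hmix τ (mixAll (τ′ ∷ τs)) ≈ₕ-refl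

{-# OPTIONS --safe #-}
-- A logical rule or a cut acts on only one
-- or two environments of its premise, whose derivation already rewrites
-- to a parallel composition of translated CP components: after reordering
-- that composition by structural congruence, the matching disentanglement
-- rewrite (1)–(6) pulls the rule onto the components typed in those
-- environments, which the corresponding CP rule combines into a single CP
-- term; the other components are untouched.  H-Mix concatenates
-- components, and the hyper-environment permutations built into every rule
-- are absorbed by permuting the components.
module Submission where

open import Defs
open import Level using (0ℓ)
open import Data.Empty using (⊥-elim)
open import Data.List using (List; []; _∷_; _++_; _∷ʳ_; [_]; map)
open import Data.List.Properties using (map-++)
open import Data.List.Membership.Propositional.Properties using (∈-++⁺ʳ)
open import Data.List.Relation.Binary.Pointwise as Pointwise using (Pointwise; []; _∷_)
import Data.List.Relation.Binary.Permutation.Propositional as ↭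
import Data.List.Relation.Binary.Permutation.Propositional.Properties as ↭-Properties
import Data.List.Relation.Binary.Permutation.Setoid as ↭ₛ
import Data.List.Relation.Binary.Permutation.Setoid.Properties as ↭ₛ-Properties
open import Data.Product using (Σ; _×_; _,_; proj₁; proj₂)
open import Relation.Binary.Bundles using (Setoid)
open import Relation.Binary.PropositionalEquality using (_≡_; refl; sym; cong; subst)
open import Relation.Binary.Construct.Closure.ReflexiveTransitive using (ε; _◅_; _◅◅_; gmap)

private
  module ≈ₕ = ↭ₛ EnvSetoid
  module ≈ₕ-Properties = ↭ₛ-Properties EnvSetoid

≡ₛ-setoid : Setoid 0ℓ 0ℓ
≡ₛ-setoid = record
  { Carrier = HCP
  ; _≈_ = _≡ₛ_
  ; isEquivalence = record { refl = ≡-refl ; sym = ≡-sym ; trans = ≡-trans }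
  }

open import Relation.Binary.Reasoning.Setoid ≡ₛ-setoid

par-∷ : ∀ T Ts → par (T ∷ Ts) ≡ₛ (T ∣ par Ts)
par-∷ T []      = ≡-sym par-unit
par-∷ T (_ ∷ _) = ≡-refl

par-++ : ∀ Ts Us → par (Ts ++ Us) ≡ₛ (par Ts ∣ par Us)
par-++ []       Us = ≡-sym (≡-trans par-comm par-unit)
par-++ (T ∷ Ts) Us = begin
  par (T ∷ Ts ++ Us)      ≈⟨ par-∷ T (Ts ++ Us) ⟩
  T ∣ par (Ts ++ Us)      ≈⟨ c-∣ ≡-refl (par-++ Ts Us) ⟩
  T ∣ (par Ts ∣ par Us)   ≈⟨ par-assoc ⟩
  (T ∣ par Ts) ∣ par Us   ≈⟨ c-∣ (par-∷ T Ts) ≡-refl ⟨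
  par (T ∷ Ts) ∣ par Us   ∎

par-↭ : ∀ {Ts Us} → Ts ↭.↭ Us → par Ts ≡ₛ par Us
par-↭ ↭.refl = ≡-refl
par-↭ (↭.prep {xs = Ts} {ys = Us} T p) = begin
  par (T ∷ Ts)   ≈⟨ par-∷ T Ts ⟩
  T ∣ par Ts     ≈⟨ c-∣ ≡-refl (par-↭ p) ⟩
  T ∣ par Us     ≈⟨ par-∷ T Us ⟨
  par (T ∷ Us)   ∎
par-↭ (↭.swap {xs = Ts} {ys = Us} T U p) = begin
  par (T ∷ U ∷ Ts)       ≈⟨ c-∣ ≡-refl (par-∷ U Ts) ⟩
  T ∣ (U ∣ par Ts)       ≈⟨ par-assoc ⟩
  (T ∣ U) ∣ par Ts       ≈⟨ c-∣ par-comm (par-↭ p) ⟩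
  (U ∣ T) ∣ par Us       ≈⟨ par-assoc ⟨
  U ∣ (T ∣ par Us)       ≈⟨ c-∣ ≡-refl (par-∷ T Us) ⟨
  par (U ∷ T ∷ Us)       ∎
par-↭ (↭.trans p q) = ≡-trans (par-↭ p) (par-↭ q)

parᶜ : List CP → HCP
parᶜ Ps = par (map ⟦_⟧ Ps)

parᶜ-++ : ∀ Ps Qs → parᶜ (Ps ++ Qs) ≡ₛ (parᶜ Ps ∣ parᶜ Qs)
parᶜ-++ Ps Qs = begin
  par (map ⟦_⟧ (Ps ++ Qs))            ≡⟨ cong par (map-++ ⟦_⟧ Ps Qs) ⟩
  par (map ⟦_⟧ Ps ++ map ⟦_⟧ Qs)      ≈⟨ par-++ (map ⟦_⟧ Ps) (map ⟦_⟧ Qs) ⟩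
  parᶜ Ps ∣ parᶜ Qs                   ∎

parᶜ-↭ : ∀ {Ps Qs} → Ps ↭.↭ Qs → parᶜ Ps ≡ₛ parᶜ Qs
parᶜ-↭ p = par-↭ (↭-Properties.map⁺ ⟦_⟧ p)

⊢cp-resp-≈ₑ : ∀ {Q Γ Γ′} → Γ′ ≈ₑ Γ → ⊢cp Q ∶ Γ → ⊢cp Q ∶ Γ′
⊢cp-resp-≈ₑ q (ax w p)       = ax w (↭.trans q p)
⊢cp-resp-≈ₑ q (cutR a b w p) = cutR a b w (↭.trans q p)
⊢cp-resp-≈ₑ q (⊗R a b w p)   = ⊗R a b w (↭.trans q p)
⊢cp-resp-≈ₑ q (⅋R a w p)     = ⅋R a w (↭.trans q p)
⊢cp-resp-≈ₑ q (𝟏R p)         = 𝟏R (↭.trans q p)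
⊢cp-resp-≈ₑ q (⊥R a w p)     = ⊥R a w (↭.trans q p)
⊢cp-resp-≈ₑ q (⊕₁R a w p)    = ⊕₁R a w (↭.trans q p)
⊢cp-resp-≈ₑ q (⊕₂R a w p)    = ⊕₂R a w (↭.trans q p)
⊢cp-resp-≈ₑ q (&R a b w p)   = &R a b w (↭.trans q p)
⊢cp-resp-≈ₑ q (⊤R w p)       = ⊤R w (↭.trans q p)

Der-resp-≈ₕ : ∀ {P 𝒦 𝒦′} → 𝒦′ ≈ₕ 𝒦 → Der P 𝒦 → Der P 𝒦′
Der-resp-≈ₕ q (ax w p)          = ax w (≈ₕ.↭-trans q p)
Der-resp-≈ₕ q (hcut d f w p)    = hcut d f w (≈ₕ.↭-trans q p)
Der-resp-≈ₕ q (hmix d e p)      = hmix d e (≈ₕ.↭-trans q p)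
Der-resp-≈ₕ {𝒦′ = []}    q hmix₀ = hmix₀
Der-resp-≈ₕ {𝒦′ = _ ∷ _} q hmix₀ = ⊥-elim (≈ₕ-Properties.¬x∷xs↭[] q)
Der-resp-≈ₕ q (⊗R d f g w p)    = ⊗R d f g w (≈ₕ.↭-trans q p)
Der-resp-≈ₕ q (⅋R d f g w p)    = ⅋R d f g w (≈ₕ.↭-trans q p)
Der-resp-≈ₕ q (𝟏R d f p)        = 𝟏R d f (≈ₕ.↭-trans q p)
Der-resp-≈ₕ q (⊥R d f w p)      = ⊥R d f w (≈ₕ.↭-trans q p)
Der-resp-≈ₕ q (⊕₁R d f w p)     = ⊕₁R d f w (≈ₕ.↭-trans q p)
Der-resp-≈ₕ q (⊕₂R d f w p)     = ⊕₂R d f w (≈ₕ.↭-trans q p)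
Der-resp-≈ₕ q (&R d e w p)      = &R d e w (≈ₕ.↭-trans q p)
Der-resp-≈ₕ q (⊤R w p)          = ⊤R w (≈ₕ.↭-trans q p)

module _ {a c ℓ r} {A : Set a} (S : Setoid c ℓ) {R : A → Setoid.Carrier S → Set r}
         (R-resp : ∀ {x u v} → Setoid._≈_ S u v → R x v → R x u) where

  open ↭ₛ S using (_↭_)

  Pointwise-resp-↭ : ∀ {us vs xs} → us ↭ vs → Pointwise R xs vs →
                     Σ (List A) λ ys → Pointwise R ys us × xs ↭.↭ ys
  Pointwise-resp-↭ (↭ₛ.refl eqs) rs = _ , resp-≋ eqs rs , ↭.refl
    where
    resp-≋ : ∀ {us vs xs} → Pointwise (Setoid._≈_ S) us vs → Pointwise R xs vs → Pointwise R xs us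
    resp-≋ []         []       = []
    resp-≋ (e ∷ eqs)  (r ∷ rs) = R-resp e r ∷ resp-≋ eqs rs
  Pointwise-resp-↭ (↭ₛ.prep e p) (r ∷ rs) with Pointwise-resp-↭ p rs
  ... | _ , rs′ , q = _ , R-resp e r ∷ rs′ , ↭.prep _ q
  Pointwise-resp-↭ (↭ₛ.swap e₁ e₂ p) (r₁ ∷ r₂ ∷ rs) with Pointwise-resp-↭ p rs
  ... | _ , rs′ , q = _ , R-resp e₁ r₂ ∷ R-resp e₂ r₁ ∷ rs′ , ↭.swap _ _ q
  Pointwise-resp-↭ (↭ₛ.trans p q) rs with Pointwise-resp-↭ q rs
  ... | _ , rs′ , q′ with Pointwise-resp-↭ p rs′
  ... | ys , rs″ , p′ = ys , rs″ , ↭.trans q′ p′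

Pointwise-++⁻ : ∀ {a b r} {A : Set a} {B : Set b} {R : A → B → Set r} (us : List B) {vs xs} →
                Pointwise R xs (us ++ vs) →
                Σ (List A) λ ys → Σ (List A) λ zs →
                xs ≡ ys ++ zs × Pointwise R ys us × Pointwise R zs vs
Pointwise-++⁻ []       rs       = [] , _ , refl , [] , rs
Pointwise-++⁻ (u ∷ us) (r ∷ rs) with Pointwise-++⁻ us rs
... | ys , zs , refl , rs₁ , rs₂ = _ ∷ ys , zs , refl , r ∷ rs₁ , rs₂

Component : CP → Env → Set
Component Q Γ = ⊢cp Q ∶ Γ × Der ⟦ Q ⟧ [ Γ ]

Components : List CP → HEnv → Set
Components = Pointwise Component

Component-resp-≈ₑ : ∀ {Q Γ Γ′} → Γ′ ≈ₑ Γ → Component Q Γ → Component Q Γ′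
Component-resp-≈ₑ q (c , d) = ⊢cp-resp-≈ₑ q c , Der-resp-≈ₕ (≈ₕ.prep q ≈ₕ.↭-refl) d

derivations : ∀ {Ps 𝒦} → Components Ps 𝒦 → Pointwise (λ Q Γ → Der ⟦ Q ⟧ [ Γ ]) Ps 𝒦
derivations = Pointwise.map proj₂

Disentangles : ∀ {𝒦} → Drv 𝒦 → Set
Disentangles {𝒦} a =
  Σ (List CP) λ Ps → Σ (Components Ps 𝒦) λ cs → a ⇝⋆ (parᶜ Ps , mixAll (derivations cs))

disentangles-upto-≡ₛ : ∀ {𝒦 ℒ T Ps} {a : Drv 𝒦} {dT : Der T 𝒦} →
                       a ⇝⋆ (T , dT) → 𝒦 ≈ₕ ℒ → Components Ps ℒ → T ≡ₛ parᶜ Ps →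
                       Disentangles a
disentangles-upto-≡ₛ a⇝⋆T 𝒦≈ℒ cs T≡Ps with Pointwise-resp-↭ EnvSetoid Component-resp-≈ₑ 𝒦≈ℒ cs
... | Qs , cs′ , Ps↭Qs =
  Qs , cs′ , a⇝⋆T ◅◅ r-≡ _ _ (≡-trans T≡Ps (parᶜ-↭ Ps↭Qs)) ◅ ε

#-++⁻ʳ : ∀ 𝒢 {ℋ x} → x # (𝒢 ++ ℋ) → x # ℋ
#-++⁻ʳ []      x#ℋ = x#ℋ
#-++⁻ʳ (Γ ∷ 𝒢) x#  = #-++⁻ʳ 𝒢 (λ x∈ → x# (∈-++⁺ʳ (names Γ) x∈))

-- A rule application with premise 𝒢 ++ 𝒜, where 𝒜 holds the environments
-- the rule acts on; extrude is its disentanglement rewrite.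
record Extrusion (𝒢 𝒜 : HEnv) (E : Env) (𝒦 : HEnv) : Set where
  field
    prefix     : HCP → HCP
    prefix-≡ₛ  : ∀ {T U} → T ≡ₛ U → prefix T ≡ₛ prefix U
    rule       : ∀ {T} → Der T (𝒢 ++ 𝒜) → Der (prefix T) 𝒦
    rule-⇝     : ∀ {T U} {d : Der T (𝒢 ++ 𝒜)} {e : Der U (𝒢 ++ 𝒜)} →
                 (T , d) ⇝ (U , e) → (prefix T , rule d) ⇝ (prefix U , rule e)
    rule₀      : ∀ {T} → Der T 𝒜 → Der (prefix T) [ E ]
    conclusion : 𝒦 ≈ₕ (E ∷ 𝒢)
    extrude    : ∀ {T U} (dT : Der T 𝒜) (dU : Der U 𝒢) →
                 (prefix (T ∣ U) , rule (hmix dT dU (≈ₕ-Properties.++-comm 𝒢 𝒜)))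
                   ⇝ ((prefix T ∣ U) , hmix (rule₀ dT) dU conclusion)
    typing     : ∀ {Ps} → Pointwise ⊢cp_∶_ Ps 𝒜 →
                 Σ CP λ P → ⊢cp P ∶ E × ⟦ P ⟧ ≡ prefix (parᶜ Ps)

module _ {𝒢 𝒜 E 𝒦} (X : Extrusion 𝒢 𝒜 E 𝒦) where
  open Extrusion X

  disentangles-extrusion : ∀ {P} {d : Der P (𝒢 ++ 𝒜)} →
                           Disentangles (P , d) → Disentangles (prefix P , rule d)
  disentangles-extrusion (Ps , cs , P⇝⋆) with Pointwise-++⁻ 𝒢 cs
  ... | Qs , Rs , refl , qs , rs with typing (Pointwise.map proj₁ rs)
  ... | R , ⊢R , ⟦R⟧≡ =
    disentangles-upto-≡ₛ
      (gmap (λ a → prefix (proj₁ a) , rule (proj₂ a)) rule-⇝ P⇝⋆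
        ◅◅ r-≡ _ _ (prefix-≡ₛ (≡-trans (parᶜ-++ Qs Rs) par-comm))
        ◅ extrude dRs (mixAll (derivations qs))
        ◅ ε)
      conclusion ((⊢R , subst (λ T → Der T [ E ]) (sym ⟦R⟧≡) (rule₀ dRs)) ∷ qs) extruded≡
    where
    dRs : Der (parᶜ Rs) 𝒜
    dRs = mixAll (derivations rs)

    extruded≡ : (prefix (parᶜ Rs) ∣ parᶜ Qs) ≡ₛ parᶜ (R ∷ Qs)
    extruded≡ = begin
      prefix (parᶜ Rs) ∣ parᶜ Qs   ≡⟨ cong (_∣ parᶜ Qs) ⟦R⟧≡ ⟨
      ⟦ R ⟧ ∣ parᶜ Qs              ≈⟨ par-∷ ⟦ R ⟧ (map ⟦_⟧ Qs) ⟨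
      parᶜ (R ∷ Qs)                ∎

≈ₕ-∷ʳ⇒∷ : ∀ 𝒢 {𝒦 E} → 𝒦 ≈ₕ (𝒢 ∷ʳ E) → 𝒦 ≈ₕ (E ∷ 𝒢)
≈ₕ-∷ʳ⇒∷ 𝒢 π = ≈ₕ.↭-trans π (≈ₕ-Properties.++-comm 𝒢 _)

module _ {𝒢 : HEnv} {𝒦 : HEnv} where

  hcut-extrusion : ∀ {x Γ Δ A} → x # (𝒢 ∷ʳ (Γ ++ Δ)) → WF (Γ ++ Δ) → 𝒦 ≈ₕ (𝒢 ∷ʳ (Γ ++ Δ)) →
                   Extrusion 𝒢 ((Γ ∷ʳ (x , A)) ∷ (Δ ∷ʳ (x , A ^⊥)) ∷ []) (Γ ++ Δ) 𝒦
  hcut-extrusion {x} {Γ} {Δ} fx wf π = record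
    { prefix     = ν x
    ; prefix-≡ₛ  = c-ν
    ; rule       = λ d → hcut d fx wf π
    ; rule-⇝     = c-hcut fx wf π
    ; rule₀      = λ d → hcut {𝒢 = []} d fx₀ wf ≈ₕ.↭-refl
    ; conclusion = ≈ₕ-∷ʳ⇒∷ 𝒢 π
    ; extrude    = λ dT dU → r-cut {𝒢 = []} dT dU _ fx wf π fx₀ wf ≈ₕ.↭-refl (≈ₕ-∷ʳ⇒∷ 𝒢 π)
    ; typing     = λ { (⊢P ∷ ⊢Q ∷ []) → cut x _ _ , cutR ⊢P ⊢Q wf ↭.refl , refl }
    }
    where
    fx₀ : x # [ Γ ++ Δ ]
    fx₀ = #-++⁻ʳ 𝒢 fx

  ⊗R-extrusion : ∀ {x y Γ Δ A B} →
                 x # 𝒢 → y # (𝒢 ∷ʳ (Γ ++ Δ ∷ʳ (x , A ⊗ B))) → WF (Γ ++ Δ ∷ʳ (x , A ⊗ B)) →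
                 𝒦 ≈ₕ (𝒢 ∷ʳ (Γ ++ Δ ∷ʳ (x , A ⊗ B))) →
                 Extrusion 𝒢 ((Γ ∷ʳ (y , A)) ∷ (Δ ∷ʳ (x , B)) ∷ []) (Γ ++ Δ ∷ʳ (x , A ⊗ B)) 𝒦
  ⊗R-extrusion {x} {y} {Γ} {Δ} {A} {B} fx fy wf π = record
    { prefix     = out x y
    ; prefix-≡ₛ  = c-out
    ; rule       = λ d → ⊗R d fx fy wf π
    ; rule-⇝     = c-⊗ fx fy wf π
    ; rule₀      = λ d → ⊗R {𝒢 = []} d (λ ()) fy₀ wf ≈ₕ.↭-refl
    ; conclusion = ≈ₕ-∷ʳ⇒∷ 𝒢 π
    ; extrude    = λ dT dU → r-⊗ {𝒢 = []} dT dU _ fx fy wf π (λ ()) fy₀ wf ≈ₕ.↭-refl (≈ₕ-∷ʳ⇒∷ 𝒢 π)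
    ; typing     = λ { (⊢P ∷ ⊢Q ∷ []) → out x y _ _ , ⊗R ⊢P ⊢Q wf ↭.refl , refl }
    }
    where
    fy₀ : y # [ Γ ++ Δ ∷ʳ (x , A ⊗ B) ]
    fy₀ = #-++⁻ʳ 𝒢 fy

  ⅋R-extrusion : ∀ {x y Γ A B} →
                 x # 𝒢 → y # (𝒢 ∷ʳ (Γ ∷ʳ (x , A ⅋ B))) → WF (Γ ∷ʳ (x , A ⅋ B)) →
                 𝒦 ≈ₕ (𝒢 ∷ʳ (Γ ∷ʳ (x , A ⅋ B))) →
                 Extrusion 𝒢 [ Γ ∷ʳ (y , A) ∷ʳ (x , B) ] (Γ ∷ʳ (x , A ⅋ B)) 𝒦
  ⅋R-extrusion {x} {y} {Γ} {A} {B} fx fy wf π = record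
    { prefix     = inp x y
    ; prefix-≡ₛ  = c-inp
    ; rule       = λ d → ⅋R d fx fy wf π
    ; rule-⇝     = c-⅋ fx fy wf π
    ; rule₀      = λ d → ⅋R {𝒢 = []} d (λ ()) fy₀ wf ≈ₕ.↭-refl
    ; conclusion = ≈ₕ-∷ʳ⇒∷ 𝒢 π
    ; extrude    = λ dT dU → r-⅋ {𝒢 = []} dT dU _ fx fy wf π (λ ()) fy₀ wf ≈ₕ.↭-refl (≈ₕ-∷ʳ⇒∷ 𝒢 π)
    ; typing     = λ { (⊢P ∷ []) → inp x y _ , ⅋R ⊢P wf ↭.refl , refl }
    }
    where
    fy₀ : y # [ Γ ∷ʳ (x , A ⅋ B) ]
    fy₀ = #-++⁻ʳ 𝒢 fy

  ⊥R-extrusion : ∀ {x Γ} → x # 𝒢 → WF (Γ ∷ʳ (x , ⊥ᵗ)) → 𝒦 ≈ₕ (𝒢 ∷ʳ (Γ ∷ʳ (x , ⊥ᵗ))) →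
                 Extrusion 𝒢 [ Γ ] (Γ ∷ʳ (x , ⊥ᵗ)) 𝒦
  ⊥R-extrusion {x} fx wf π = record
    { prefix     = wait x
    ; prefix-≡ₛ  = c-wait
    ; rule       = λ d → ⊥R d fx wf π
    ; rule-⇝     = c-⊥ fx wf π
    ; rule₀      = λ d → ⊥R {𝒢 = []} d (λ ()) wf ≈ₕ.↭-refl
    ; conclusion = ≈ₕ-∷ʳ⇒∷ 𝒢 π
    ; extrude    = λ dT dU → r-⊥ {𝒢 = []} dT dU _ fx wf π (λ ()) wf ≈ₕ.↭-refl (≈ₕ-∷ʳ⇒∷ 𝒢 π)
    ; typing     = λ { (⊢P ∷ []) → wait x _ , ⊥R ⊢P wf ↭.refl , refl }
    }

  ⊕₁R-extrusion : ∀ {x Γ A B} → x # 𝒢 → WF (Γ ∷ʳ (x , A ⊕ B)) → 𝒦 ≈ₕ (𝒢 ∷ʳ (Γ ∷ʳ (x , A ⊕ B))) →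
                  Extrusion 𝒢 [ Γ ∷ʳ (x , A) ] (Γ ∷ʳ (x , A ⊕ B)) 𝒦
  ⊕₁R-extrusion {x} fx wf π = record
    { prefix     = inl x
    ; prefix-≡ₛ  = c-inl
    ; rule       = λ d → ⊕₁R d fx wf π
    ; rule-⇝     = c-⊕₁ fx wf π
    ; rule₀      = λ d → ⊕₁R {𝒢 = []} d (λ ()) wf ≈ₕ.↭-refl
    ; conclusion = ≈ₕ-∷ʳ⇒∷ 𝒢 π
    ; extrude    = λ dT dU → r-⊕₁ {𝒢 = []} dT dU _ fx wf π (λ ()) wf ≈ₕ.↭-refl (≈ₕ-∷ʳ⇒∷ 𝒢 π)
    ; typing     = λ { (⊢P ∷ []) → inl x _ , ⊕₁R ⊢P wf ↭.refl , refl }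
    }

  ⊕₂R-extrusion : ∀ {x Γ A B} → x # 𝒢 → WF (Γ ∷ʳ (x , A ⊕ B)) → 𝒦 ≈ₕ (𝒢 ∷ʳ (Γ ∷ʳ (x , A ⊕ B))) →
                  Extrusion 𝒢 [ Γ ∷ʳ (x , B) ] (Γ ∷ʳ (x , A ⊕ B)) 𝒦
  ⊕₂R-extrusion {x} fx wf π = record
    { prefix     = inr x
    ; prefix-≡ₛ  = c-inr
    ; rule       = λ d → ⊕₂R d fx wf π
    ; rule-⇝     = c-⊕₂ fx wf π
    ; rule₀      = λ d → ⊕₂R {𝒢 = []} d (λ ()) wf ≈ₕ.↭-refl
    ; conclusion = ≈ₕ-∷ʳ⇒∷ 𝒢 π
    ; extrude    = λ dT dU → r-⊕₂ {𝒢 = []} dT dU _ fx wf π (λ ()) wf ≈ₕ.↭-refl (≈ₕ-∷ʳ⇒∷ 𝒢 π)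
    ; typing     = λ { (⊢P ∷ []) → inr x _ , ⊕₂R ⊢P wf ↭.refl , refl }
    }

disentangle : ∀ {P 𝒦} (ρ : Der P 𝒦) → Disentangles (P , ρ)
disentangle (ax w π) = disentangles-upto-≡ₛ ε π ((ax w ↭.refl , ax w ≈ₕ.↭-refl) ∷ []) ≡-refl
disentangle hmix₀ = [] , [] , ε
disentangle (hmix {Q = Q} {𝒢 = 𝒢} dP dQ π) with disentangle dP | disentangle dQ
... | Ps , cs , P⇝⋆ | Qs , ds , Q⇝⋆ =
  disentangles-upto-≡ₛ
    (gmap (λ a → (proj₁ a ∣ Q) , hmix (proj₂ a) dQ π) (c-mixˡ dQ π) P⇝⋆
      ◅◅ gmap (λ a → (parᶜ Ps ∣ proj₁ a) , hmix dPs (proj₂ a) π) (c-mixʳ dPs π) Q⇝⋆)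
    π (Pointwise.++⁺ cs ds) (≡-sym (parᶜ-++ Ps Qs))
  where
  dPs : Der (parᶜ Ps) 𝒢
  dPs = mixAll (derivations cs)
disentangle (hcut d fx wf π)      = disentangles-extrusion (hcut-extrusion fx wf π) (disentangle d)
disentangle (⊗R d fx fy wf π)     = disentangles-extrusion (⊗R-extrusion fx fy wf π) (disentangle d)
disentangle (⅋R d fx fy wf π)     = disentangles-extrusion (⅋R-extrusion fx fy wf π) (disentangle d)
disentangle (⊥R d fx wf π)        = disentangles-extrusion (⊥R-extrusion fx wf π) (disentangle d)
disentangle (⊕₁R d fx wf π)       = disentangles-extrusion (⊕₁R-extrusion fx wf π) (disentangle d)
disentangle (⊕₂R d fx wf π)       = disentangles-extrusion (⊕₂R-extrusion fx wf π) (disentangle d)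
disentangle (𝟏R {x} {𝒢 = 𝒢} d fx π) with disentangle d
... | Ps , cs , P⇝⋆ =
  disentangles-upto-≡ₛ
    (gmap (λ a → halt x (proj₁ a) , 𝟏R (proj₂ a) fx π) (c-𝟏 fx π) P⇝⋆
      ◅◅ r-𝟏 (mixAll (derivations cs)) fx π (λ ()) ≈ₕ.↭-refl (≈ₕ-∷ʳ⇒∷ 𝒢 π)
      ◅ ε)
    (≈ₕ-∷ʳ⇒∷ 𝒢 π) ((𝟏R ↭.refl , 𝟏R hmix₀ (λ ()) ≈ₕ.↭-refl) ∷ cs) (≡-sym (par-∷ _ (map ⟦_⟧ Ps)))
disentangle (&R {x} {Q = Q} d e wf π) with disentangle d | disentangle e
... | Ps , (⊢P , dP) ∷ [] , P⇝⋆ | _ , (⊢Q , dQ) ∷ [] , Q⇝⋆ =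
  disentangles-upto-≡ₛ
    (gmap (λ a → case x (proj₁ a) Q , &R (proj₂ a) e wf π) (c-&ˡ e wf π) P⇝⋆
      ◅◅ gmap (λ a → case x (parᶜ Ps) (proj₁ a) , &R dP (proj₂ a) wf π) (c-&ʳ dP wf π) Q⇝⋆)
    π ((&R ⊢P ⊢Q wf ↭.refl , &R dP dQ wf ≈ₕ.↭-refl) ∷ []) ≡-refl
disentangle (⊤R w π) = disentangles-upto-≡ₛ ε π ((⊤R w ↭.refl , ⊤R w ≈ₕ.↭-refl) ∷ []) ≡-refl

lemma33 : (P : HCP) (Γs : List Env) (ρ : Der P Γs) →
    Σ (List CP) λ Ps →
    Σ (Pointwise (λ Q Γ → ⊢cp Q ∶ Γ) Ps Γs) λ _ →
    Σ (Pointwise (λ Q Γ → Der ⟦ Q ⟧ [ Γ ]) Ps Γs) λ τs →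
      (P , ρ) ⇝⋆ (par (map ⟦_⟧ Ps) , mixAll τs)
lemma33 P Γs ρ with disentangle ρ
... | Ps , cs , ρ⇝⋆ = Ps , Pointwise.map proj₁ cs , derivations cs , ρ⇝⋆
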